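{- Let $n\geq 1$, $T\in\mathcal T_{r,s,b}(n)$, and let $\Gamma$, $a_0,\dots,a_\ell$ and $\lambda$ be as in the context. Let $\Gamma_0=\Gamma$ and for $1\leq k\leq 2n-1$ let $\Gamma_k$ be obtained from $\Gamma_{k-1}$ by closing an admissible triple, labels being propagated by letting both angles created when a stem is attached into an angle inherit the label of that angle. Then for every $0\leq k\leq 2n-1$: the root angle of $\Gamma_k$ has label $3$, and walking clockwise around the special face of $\Gamma_k$ starting from its root angle, the labels increase by one around a stem and decrease by one along an edge, finishing at label $0$ at the last angle. In particular, for each stem $s$ of $\Gamma$, $\lambda(a(s))=\lambda(s)-1$. Moreover, all angles of $\Gamma$ that appear strictly between $s$ and $a(s)$ in clockwise order along the face of $\Gamma$ have labels greater than or equal to $\lambda(s)$.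
   Context: Unicellular maps. A map on the torus is a graph embedded in the torus with all faces homeomorphic to open disks; an angle is a pair of consecutive half-edges around a vertex. A toroidal unicellular map is a map on the torus with one face; its special vertices are those lying on all its cycles (exactly one in the square case, exactly two in the hexagonal case). A stem is a half-edge attached to an angle of a vertex with dangling other extremity, oriented away from its vertex. $\mathcal T_r(n)$ is the set of toroidal unicellular maps with $n$ vertices, $n+1$ edges and $2n-1$ stems, rooted at an angle (root angle, whose vertex is the root vertex), such that a non-root vertex carries $2$ stems if not special, $1$ if a special vertex of a hexagonal map, $0$ if the special vertex of a square map; the root vertex carries one more stem than this rule prescribes, one of which (root stem) is incident to the root angle and immediately follows it in counterclockwise order around the root vertex. Closure. For $T\in\mathcal T_r(n)$, $T_0=T$ has special face its unique face. In $T_k$, an admissible triple is a sequence $(e_1,e_2,s)$ appearing consecutively in counterclockwise order along the border of the special face, with $e_1=(u,v)$, $e_2=(v,w)$ edges and $s$ a stem at $w$; closing it attaches $s$ to $u$, creating an edge $(w,u)$ and a triangular face $uvw$ on its left; the next map is obtained by closing an admissible triple and its special face is the face on the right of the closed stem. Admissible triples always exist and after $2n-1$ closures one gets a toroidal triangulation (complete closure). When a stem is attached into the root angle the root angle is kept on its right side. $T$ is safe if each time a stem is attached the root angle lies on its right side in the special face. Balance. The canonical orientation of $T$ orients stems outward and orients each edge counterclockwise with respect to the face the first time it is met walking clockwise around the face from the root angle. For a cycle $C$ with traversal direction, $\gamma(C)$ = (number of outgoing edges and stems incident to its right side) minus (number incident to its left side); $T$ is balanced if $\gamma(C)=0$ for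 all cycles $C$. $\mathcal T_{r,s,b}(n)$ is the set of safe balanced elements of $\mathcal T_r(n)$. Labels. $\Gamma$ is $T$ with an extra dangling half-edge (the root half-edge, not a stem) added in the root angle; the closure of $T$ is performed on $\Gamma$ in the same way (the root half-edge stays on the right of every attached stem), and the root angle of $\Gamma$ (and of each $\Gamma_k$) is the angle just after the root half-edge in counterclockwise order around its vertex. With $\ell=4n+1$, $a_0,\dots,a_\ell$ are the angles of $\Gamma$ in clockwise order around its face starting at the root angle $a_0$. $\lambda(a_0)=3$, $\lambda(a_{i+1})=\lambda(a_i)+1$ if $a_i,a_{i+1}$ are consecutive around a stem, $\lambda(a_{i+1})=\lambda(a_i)-1$ if consecutive along an edge. For a stem $s$ of $\Gamma$, $\lambda(s)$ is the label of the angle just before $s$ in counterclockwise order around its vertex, and $a(s)$ is the angle of $\Gamma$ from which (after successive splittings) comes the angle to which $s$ is attached during the complete closure. -}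

module Defs where

open import Data.Nat as ℕ using (ℕ; zero; suc; _+_; _*_; _∸_; _≤_; _<_; _<ᵇ_)
open import Data.Integer as ℤ using (ℤ; 0ℤ; 1ℤ; -1ℤ; +_) renaming (_+_ to _+ℤ_; _-_ to _-ℤ_; _≤_ to _≤ℤ_)
open import Data.Fin as Fin using (Fin; zero; suc; _≟_)
open import Data.Bool using (Bool; true; false; if_then_else_; _∧_; _∨_; not; T)
open import Data.List using (List; []; _∷_)
open import Data.Product using (Σ; ∃; _×_; _,_)
open import Data.Sum using (_⊎_)
open import Relation.Nullary using (¬_)
open import Relation.Nullary.Decidable using (⌊_⌋)
open import Relation.Binary.PropositionalEquality using (_≡_; _≢_)

iter : ∀ {A : Set} → ℕ → (A → A) → A → A
iter zero    f a = a
iter (suc i) f a = f (iter i f a)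

cnt : ∀ {d} → (Fin d → Bool) → ℕ
cnt {zero}  p = 0
cnt {suc d} p = (if p zero then 1 else 0) + cnt (λ g → p (suc g))

cntL : ∀ {A : Set} → (A → Bool) → List A → ℕ
cntL p []       = 0
cntL p (x ∷ xs) = (if p x then 1 else 0) + cntL p xs

sumZ : ∀ {m} → (Fin m → ℤ) → ℤ
sumZ {zero}  f = 0ℤ
sumZ {suc m} f = f zero +ℤ sumZ (λ i → f (suc i))

-- least i < fuel with p i, or fuel if there is none
first : ℕ → (ℕ → Bool) → ℕ
first zero    p = zero
first (suc f) p = if p zero then zero else suc (first f (λ i → p (suc i)))

-- cyclic successor on Fin (suc m)
nxt : ∀ {m} → Fin (suc m) → Fin (suc m)
nxt {zero}  _ = zero
nxt {suc m} zero = suc zero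
nxt {suc m} (suc i) with nxt {m} i
... | zero  = zero
... | suc j = suc (suc j)

-- Darts (half-edges) are Fin d.  σ = counterclockwise successor around the
-- vertex, α = opposite half-edge (fixed points = dangling half-edges: the
-- stems and the root half-edge 'root').  The angle "indexed by" a dart g is
-- the angle just before g in counterclockwise order around its vertex,
-- i.e. the corner between (σ⁻¹ g) and g.  Walking clockwise around a face,
-- the angle following the angle indexed by g is the one indexed by φ g = σ (α g):
-- if g is a stem the two angles are consecutive around the stem, otherwise
-- they are consecutive along the edge of g.

record PreMap (d : ℕ) : Set where
  field
    σ    : Fin d → Fin d
    α    : Fin d → Fin d
    root : Fin d
open PreMap public

module _ {d} (M : PreMap d) where

  φ : Fin d → Fin d
  φ g = σ M (α M g)

  -- root angle: the angle just after the root half-edge in ccw order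
  ρ : Fin d
  ρ = σ M (root M)

  isFixed : Fin d → Bool
  isFixed g = ⌊ α M g ≟ g ⌋

  isStem : Fin d → Bool
  isStem g = isFixed g ∧ not ⌊ g ≟ root M ⌋

  isEdge : Fin d → Bool
  isEdge g = not (isFixed g)

  SameVertex : Fin d → Fin d → Set
  SameVertex g h = ∃ λ i → iter i (σ M) g ≡ h

  SameFace : Fin d → Fin d → Set
  SameFace g h = ∃ λ i → iter i φ g ≡ h

  pos : Fin d → ℕ
  pos g = first d (λ i → ⌊ iter i φ ρ ≟ g ⌋)

  stepZ : Fin d → ℤ
  stepZ g = if isFixed g then 1ℤ else -1ℤ

  lab : ℕ → ℤ
  lab zero    = + 3
  lab (suc i) = lab i +ℤ stepZ (iter i φ ρ)

  λ₀ : Fin d → ℤ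
  λ₀ g = lab (pos g)

  -- canonical orientation: a dart is outgoing if it is a stem, or an edge dart
  -- whose opposite dart is met first in the clockwise walk from the root angle
  -- (the edge is oriented counterclockwise w.r.t. the face at its first side).
  isOut : Fin d → Bool
  isOut g = isStem g ∨ (isEdge g ∧ (pos (α M g) <ᵇ pos g))

  arc : ℕ → Fin d → Fin d → List (Fin d)
  arc zero    a b = []
  arc (suc f) a b = if ⌊ σ M a ≟ b ⌋ then [] else (σ M a ∷ arc f (σ M a) b)

  record Cycle {n} (vtx : Fin d → Fin n) : Set where
    field
      len       : ℕ
      c         : Fin (suc len) → Fin d   -- c i : dart leaving the i-th vertex
      c-edge    : ∀ i → T (isEdge (c i))
      c-closed  : ∀ i → vtx (α M (c i)) ≡ vtx (c (nxt i))
      c-distV   : ∀ i j → vtx (c i) ≡ vtx (c j) → i ≡ j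
      c-distE   : ∀ i j → c i ≡ c j ⊎ c i ≡ α M (c j) → i ≡ j
  open Cycle public

  -- γ(C) = #outgoing edges/stems on the right - #on the left
  γ : ∀ {n} {vtx : Fin d → Fin n} → Cycle vtx → ℤ
  γ C = sumZ (λ i →
      (+ cntL isOut (arc d (α M (c C i)) (c C (nxt i))))
      -ℤ (+ cntL isOut (arc d (c C (nxt i)) (α M (c C i)))))

  Balanced : ∀ {n} → (Fin d → Fin n) → Set
  Balanced vtx = ∀ (C : Cycle vtx) → γ C ≡ 0ℤ

  Special : ∀ {n} → (Fin d → Fin n) → Fin n → Set
  Special vtx v = ∀ (C : Cycle vtx) → ∃ λ i → vtx (c C i) ≡ v

  SquareMap : ∀ {n} → (Fin d → Fin n) → Set
  SquareMap vtx = ∃ λ v → Special vtx v × (∀ w → Special vtx w → w ≡ v)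

  HexMap : ∀ {n} → (Fin d → Fin n) → Set
  HexMap vtx = ∃ λ v → ∃ λ w → v ≢ w × Special vtx v × Special vtx w
               × (∀ u → Special vtx u → u ≡ v ⊎ u ≡ w)

  stemsAt : ∀ {n} → (Fin d → Fin n) → Fin n → ℕ
  stemsAt vtx v = cnt (λ g → isStem g ∧ ⌊ vtx g ≟ v ⌋)

  rootExtra : ∀ {n} → (Fin d → Fin n) → Fin n → ℕ
  rootExtra vtx v = if ⌊ vtx (root M) ≟ v ⌋ then 1 else 0

  -- Γ is T plus the root half-edge, T ∈ 𝒯_r(n)
  record InTr (n : ℕ) : Set where
    field
      σ-inj      : ∀ g h → σ M g ≡ σ M h → g ≡ h
      α-invol    : ∀ g → α M (α M g) ≡ g
      α-root     : α M (root M) ≡ root M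
      vtx        : Fin d → Fin n
      vtx-same   : ∀ g h → vtx g ≡ vtx h → SameVertex g h
      same-vtx   : ∀ g h → SameVertex g h → vtx g ≡ vtx h
      vtx-surj   : ∀ v → ∃ λ g → vtx g ≡ v
      one-face   : ∀ g h → SameFace g h
      edge-count : cnt isEdge ≡ 2 * (n + 1)
      stem-count : cnt isStem ≡ 2 * n ∸ 1
      root-stem  : T (isStem (σ M (root M)))
      stem-rule  : ∀ v →
          (¬ Special vtx v → stemsAt vtx v ≡ 2 + rootExtra vtx v)
        × (Special vtx v → HexMap vtx → stemsAt vtx v ≡ 1 + rootExtra vtx v)
        × (Special vtx v → SquareMap vtx → stemsAt vtx v ≡ rootExtra vtx v)
  open InTr public

  σT : Fin d → Fin d
  σT g = if ⌊ σ M g ≟ root M ⌋ then σ M (root M) else σ M g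

  -- for a stem s at w: x = e2 at w, y = e1 at v, α y at u, and
  -- attachAngle s = the angle of u into which s is attached
  xOf yOf attachAngle : Fin d → Fin d
  xOf s = σT s
  yOf s = σT (α M (xOf s))
  attachAngle s = σ M (α M (yOf s))

  Admissible : Fin d → Fin d → Set
  Admissible sp s = T (isStem s) × T (isEdge (xOf s)) × T (isEdge (yOf s)) × SameFace sp s

  -- new dart = zero, old dart g = suc g.  The new half-edge is inserted at u
  -- right after α y (hence before the root half-edge if it lies there).
  close : Fin d → PreMap (suc d)
  close s = record { σ = σ' ; α = α' ; root = suc (root M) }
    where
    σ' : Fin (suc d) → Fin (suc d)
    σ' zero    = suc (attachAngle s)
    σ' (suc g) = if ⌊ g ≟ α M (yOf s) ⌋ then zero else suc (σ M g)
    α' : Fin (suc d) → Fin (suc d)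
    α' zero    = suc s
    α' (suc g) = if ⌊ g ≟ s ⌋ then zero else suc (α M g)

-- Closure sequences: ch k is the stem closed in Γ_k.

module Closure {d₀} (M₀ : PreMap d₀) (ch : (k : ℕ) → Fin (k + d₀)) where

  Γ : (k : ℕ) → PreMap (k + d₀)
  Γ zero    = M₀
  Γ (suc k) = close (Γ k) (ch k)

  -- a dart of the special face of Γ_k
  sp : (k : ℕ) → Fin (k + d₀)
  sp zero    = ρ M₀
  sp (suc k) = suc (ch k)

  -- angle of Γ from which each angle of Γ_k comes (after successive splittings)
  origin : (k : ℕ) → Fin (k + d₀) → Fin d₀
  origin zero    g       = g
  origin (suc k) zero    = origin k (attachAngle (Γ k) (ch k))
  origin (suc k) (suc g) = origin k g

  L : (k : ℕ) → Fin (k + d₀) → ℤ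
  L zero    g       = λ₀ M₀ g
  L (suc k) zero    = L k (attachAngle (Γ k) (ch k))
  L (suc k) (suc g) = L k g

  Valid : ℕ → Set
  Valid K = ∀ k → k < K → Admissible (Γ k) (sp k) (ch k)

  -- the root angle lies on the right side of the k-th closed stem
  RootRight : ℕ → Set
  RootRight k = SameFace (Γ (suc k)) (suc (ch k)) (ρ (Γ (suc k)))

  WalkOK : ℕ → Set
  WalkOK k =
      SameFace (Γ k) (sp k) (ρ (Γ k))
    × L k (ρ (Γ k)) ≡ + 3
    × (∀ i → (∀ j → j ≤ i → iter j (φ (Γ k)) (ρ (Γ k)) ≢ root (Γ k)) →
        let g = iter i (φ (Γ k)) (ρ (Γ k)) in
          (T (isStem (Γ k) g) → L k (φ (Γ k) g) ≡ L k g +ℤ 1ℤ)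
        × (T (isEdge (Γ k) g) → L k (φ (Γ k) g) ≡ L k g -ℤ 1ℤ))
    × L k (root (Γ k)) ≡ 0ℤ

  AttachOK : ℕ → Set
  AttachOK k =
    let s = origin k (ch k) ; a = origin k (attachAngle (Γ k) (ch k)) in
      λ₀ M₀ a ≡ λ₀ M₀ s -ℤ 1ℤ
    × (∀ j → 1 ≤ j → (∀ t → 1 ≤ t → t ≤ j → iter t (φ M₀) s ≢ a) →
        λ₀ M₀ s ≤ℤ λ₀ M₀ (iter j (φ M₀) s))

Safe : ∀ {d} → ℕ → PreMap d → Set
Safe K M = ∀ ch → Closure.Valid M ch K → ∀ k → k < K → Closure.RootRight M ch k

-- Labels are inherited, so every angle of Γ_k carries the label of the angle of Γ it comes from,
-- and it suffices to follow the clockwise walk around the special face from the root angle. In Γ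
-- this walk meets every dart once, so its labels telescope: after the root half-edge the label is
-- 3 + #fixed darts − #edge darts = 3 + 2n − (2n + 2) = 1, hence the last angle has label 0.
-- Safety forces each closed triple to occupy three consecutive steps s, e₂, e₁ of the walk that
-- do not pass the root half-edge; closing it replaces the steps +1, −1, −1 by a single −1, so the
-- walk of Γ_{k+1} is that of Γ_k with two steps removed and labels unchanged, and a(s) follows s
-- with label λ(s) − 1. Each angle of Γ removed from the walk so far lies between two consecutive
-- angles of the current walk and has label at least that of the first one; this invariant yields
-- the bound on the labels between s and a(s).

module Submission where

open import Defs
open import Data.Nat using (ℕ; zero; suc; _+_; _*_; _∸_; _≤_; _<_; z≤n; s≤s; s≤s⁻¹; _≤?_; _<?_)
import Data.Nat.Properties as ℕₚ
open import Data.Integer as ℤ using (ℤ; +_; 0ℤ; 1ℤ; -1ℤ; -[1+_]; _⊖_)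
  renaming (_+_ to _+ℤ_; _-_ to _-ℤ_; _≤_ to _≤ℤ_)
import Data.Integer.Properties as ℤₚ
open import Data.Fin using (Fin; zero; suc; _≟_; toℕ; fromℕ<)
import Data.Fin.Properties as Finₚ
open import Data.Fin.Permutation using (Permutation; permutation)
open import Data.Bool using (Bool; true; false; T; _∧_; not; if_then_else_)
open import Data.Empty using (⊥; ⊥-elim)
open import Data.Product using (Σ; _×_; _,_; proj₁; proj₂)
open import Data.Sum using (_⊎_; inj₁; inj₂)
open import Relation.Binary using (tri<; tri≈; tri>)
open import Relation.Binary.PropositionalEquality
  using (_≡_; _≢_; refl; sym; trans; cong; cong₂; subst; subst₂; module ≡-Reasoning)
open import Relation.Nullary using (¬_; Dec; yes; no)
open import Relation.Nullary.Decidable using (⌊_⌋; isYes≗does; dec-true; dec-false)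
open import Algebra.Properties.CommutativeMonoid.Sum ℤₚ.+-0-commutativeMonoid using (sum; sum-permute)

iter-+ : ∀ {A : Set} (i j : ℕ) (f : A → A) (a : A) → iter (i + j) f a ≡ iter i f (iter j f a)
iter-+ zero    j f a = refl
iter-+ (suc i) j f a = cong f (iter-+ i j f a)

least : (P : ℕ → Set) → (∀ j → Dec (P j)) → ∀ i → P i →
  Σ ℕ λ m → P m × (∀ j → j < m → ¬ P j)
least P P? zero    Pi = zero , Pi , λ _ ()
least P P? (suc i) Pi with P? zero
... | yes P0 = zero , P0 , λ _ ()
... | no ¬P0 with least (λ j → P (suc j)) (λ j → P? (suc j)) i Pi
...   | m , Pm , below = suc m , Pm , λ { zero _ → ¬P0 ; (suc j) (s≤s j<m) → below j j<m }

if-true : ∀ {A : Set} {b : Bool} {x y : A} → b ≡ true → (if b then x else y) ≡ x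
if-true refl = refl

if-false : ∀ {A : Set} {b : Bool} {x y : A} → b ≡ false → (if b then x else y) ≡ y
if-false refl = refl

⌊≟⌋-refl : ∀ {D} (g : Fin D) → ⌊ g ≟ g ⌋ ≡ true
⌊≟⌋-refl g = trans (isYes≗does (g ≟ g)) (dec-true (g ≟ g) refl)

⌊≟⌋-≢ : ∀ {D} {g h : Fin D} → g ≢ h → ⌊ g ≟ h ⌋ ≡ false
⌊≟⌋-≢ {g = g} {h} g≢h = trans (isYes≗does (g ≟ h)) (dec-false (g ≟ h) g≢h)

⌊suc≟suc⌋ : ∀ {D} (g h : Fin D) → ⌊ suc g ≟ suc h ⌋ ≡ ⌊ g ≟ h ⌋
⌊suc≟suc⌋ g h with g ≟ h
... | yes _ = refl
... | no _  = refl

iter-preserves : ∀ {A : Set} (P : A → Set) {f : A → A} → (∀ a → P a → P (f a)) →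
  ∀ i {a} → P a → P (iter i f a)
iter-preserves P step zero    Pa = Pa
iter-preserves P step (suc i) Pa = step _ (iter-preserves P step i Pa)

first-least : ∀ F (p : ℕ → Bool) j → j < F → p j ≡ true → (∀ i → i < j → p i ≡ false) →
  first F p ≡ j
first-least (suc F) p zero    _         pj _     = if-true pj
first-least (suc F) p (suc j) (s≤s j<F) pj below =
  trans (if-false (below 0 (s≤s z≤n)))
        (cong suc (first-least F (λ i → p (suc i)) j j<F pj (λ i i<j → below (suc i) (s≤s i<j))))

cnt-cong : ∀ {D} {b e : Fin D → Bool} → (∀ g → b g ≡ e g) → cnt b ≡ cnt e
cnt-cong {zero}  b≗e = refl
cnt-cong {suc D} b≗e =
  cong₂ _+_ (cong (λ z → if z then 1 else 0) (b≗e zero)) (cnt-cong (λ g → b≗e (suc g)))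

cnt-∧-split : ∀ {D} (b e : Fin D → Bool) →
  cnt b ≡ cnt (λ g → b g ∧ not (e g)) + cnt (λ g → b g ∧ e g)
cnt-∧-split {zero}  b e = refl
cnt-∧-split {suc D} b e with b zero | e zero | cnt-∧-split (λ g → b (suc g)) (λ g → e (suc g))
... | false | _     | ih = ih
... | true  | true  | ih = trans (cong suc ih) (sym (ℕₚ.+-suc _ _))
... | true  | false | ih = cong suc ih

cnt-≟ : ∀ {D} (r : Fin D) → cnt (λ g → ⌊ g ≟ r ⌋) ≡ 1
cnt-≟ {suc D} zero    = cong suc (cnt-suc≟zero D)
  where
  cnt-suc≟zero : ∀ D → cnt {D} (λ g → ⌊ suc g ≟ zero ⌋) ≡ 0
  cnt-suc≟zero zero    = refl
  cnt-suc≟zero (suc D) = cnt-suc≟zero D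
cnt-≟ {suc D} (suc r) = trans (cnt-cong (λ g → ⌊suc≟suc⌋ g r)) (cnt-≟ r)

sumZ-±1 : ∀ {D} (b : Fin D → Bool) →
  sumZ (λ g → if b g then 1ℤ else -1ℤ) ≡ + cnt b -ℤ + cnt (λ g → not (b g))
sumZ-±1 {zero}  b = refl
sumZ-±1 {suc D} b with b zero | sumZ-±1 (λ g → b (suc g))
... | true  | ih = trans (cong (1ℤ +ℤ_) ih)
  (sym (ℤₚ.+-assoc 1ℤ (+ cnt (λ g → b (suc g))) (ℤ.- + cnt (λ g → not (b (suc g))))))
... | false | ih = trans (cong (-1ℤ +ℤ_) ih)
  (shift (cnt (λ g → b (suc g))) (cnt (λ g → not (b (suc g)))))
  where
  shift : ∀ a c → -1ℤ +ℤ (+ a -ℤ + c) ≡ + a -ℤ + (1 + c)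
  shift a c = begin
    -1ℤ +ℤ (+ a -ℤ + c)      ≡⟨ sym (ℤₚ.+-assoc -1ℤ (+ a) (ℤ.- + c)) ⟩
    (-1ℤ +ℤ + a) +ℤ ℤ.- + c  ≡⟨ cong (_+ℤ ℤ.- + c) (ℤₚ.+-comm -1ℤ (+ a)) ⟩
    (+ a +ℤ -1ℤ) +ℤ ℤ.- + c  ≡⟨ ℤₚ.+-assoc (+ a) -1ℤ (ℤ.- + c) ⟩
    + a +ℤ (-1ℤ +ℤ ℤ.- + c)  ≡⟨ cong (+ a +ℤ_) (sym (ℤₚ.neg-distrib-+ 1ℤ (+ c))) ⟩
    + a -ℤ + (1 + c)         ∎
    where open ≡-Reasoning

sum≡sumZ : ∀ {k} (f : Fin k → ℤ) → sum f ≡ sumZ f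
sum≡sumZ {zero}  f = refl
sum≡sumZ {suc k} f = cong (f zero +ℤ_) (sum≡sumZ (λ i → f (suc i)))

prefixSum : (ℕ → ℤ) → ℕ → ℤ
prefixSum h zero    = 0ℤ
prefixSum h (suc i) = prefixSum h i +ℤ h i

prefixSum-suc : ∀ (h : ℕ → ℤ) i → prefixSum h (suc i) ≡ h 0 +ℤ prefixSum (λ j → h (suc j)) i
prefixSum-suc h zero    = trans (ℤₚ.+-identityˡ (h 0)) (sym (ℤₚ.+-identityʳ (h 0)))
prefixSum-suc h (suc i) = trans (cong (_+ℤ h (suc i)) (prefixSum-suc h i))
  (ℤₚ.+-assoc (h 0) (prefixSum (λ j → h (suc j)) i) (h (suc i)))

sumZ≡prefixSum : ∀ k (h : ℕ → ℤ) → sumZ {k} (λ j → h (toℕ j)) ≡ prefixSum h k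
sumZ≡prefixSum zero    h = refl
sumZ≡prefixSum (suc k) h =
  trans (cong (h 0 +ℤ_) (sumZ≡prefixSum k (λ j → h (suc j)))) (sym (prefixSum-suc h k))

-- Removing two steps from a walk

skip : ℕ → ℕ → ℕ
skip p j = if ⌊ j ≤? p ⌋ then j else suc (suc j)

skip-≤ : ∀ {p j} → j ≤ p → skip p j ≡ j
skip-≤ {p} {j} j≤p = if-true (trans (isYes≗does (j ≤? p)) (dec-true (j ≤? p) j≤p))

skip-> : ∀ {p j} → p < j → skip p j ≡ suc (suc j)
skip-> {p} {j} p<j = if-false (trans (isYes≗does (j ≤? p)) (dec-false (j ≤? p) (ℕₚ.<⇒≱ p<j)))

skip-suc : ∀ {p j} → j ≢ p → skip p (suc j) ≡ suc (skip p j)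
skip-suc {p} {j} j≢p with ℕₚ.<-cmp j p
... | tri< j<p _ _ = trans (skip-≤ j<p) (cong suc (sym (skip-≤ (ℕₚ.<⇒≤ j<p))))
... | tri≈ _ j≡p _ = ⊥-elim (j≢p j≡p)
... | tri> _ _ p<j = trans (skip-> (ℕₚ.m<n⇒m<1+n p<j)) (cong suc (sym (skip-> p<j)))

skip-≢ : ∀ {p j} → j ≢ p → skip p j ≢ p
skip-≢ {p} {j} j≢p with ℕₚ.<-cmp j p
... | tri< j<p _ _ = subst (_≢ p) (sym (skip-≤ (ℕₚ.<⇒≤ j<p))) j≢p
... | tri≈ _ j≡p _ = ⊥-elim (j≢p j≡p)
... | tri> _ _ p<j = subst (_≢ p) (sym (skip-> p<j))
        (ℕₚ.>⇒≢ (ℕₚ.m<n⇒m<1+n (ℕₚ.m<n⇒m<1+n p<j)))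

skip-≢2+ : ∀ {p j} → j ≢ p → skip p j ≢ suc (suc p)
skip-≢2+ {p} {j} j≢p with ℕₚ.<-cmp j p
... | tri< j<p _ _ = subst (_≢ suc (suc p)) (sym (skip-≤ (ℕₚ.<⇒≤ j<p)))
        (ℕₚ.<⇒≢ (ℕₚ.m<n⇒m<1+n (ℕₚ.m<n⇒m<1+n j<p)))
... | tri≈ _ j≡p _ = ⊥-elim (j≢p j≡p)
... | tri> _ _ p<j = subst (_≢ suc (suc p)) (sym (skip-> p<j))
        (λ e → j≢p (ℕₚ.suc-injective (ℕₚ.suc-injective e)))

skip-cases : ∀ p j → (j ≤ p × skip p j ≡ j) ⊎ (p < j × skip p j ≡ suc (suc j))
skip-cases p j with j ≤? p
... | yes j≤p = inj₁ (j≤p , refl)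
... | no  j≰p = inj₂ (ℕₚ.≰⇒> j≰p , refl)

skip-≤-2+ : ∀ {p j n} → j ≤ n → skip p j ≤ suc (suc n)
skip-≤-2+ {p} {j} j≤n with skip-cases p j
... | inj₁ (_ , e) = subst (_≤ _) (sym e) (ℕₚ.m≤n⇒m≤o+n 2 j≤n)
... | inj₂ (_ , e) = subst (_≤ _) (sym e) (s≤s (s≤s j≤n))

skip-<-2+ : ∀ {p j n} → j < n → skip p j < suc (suc n)
skip-<-2+ {p} {j} j<n with skip-cases p j
... | inj₁ (_ , e) = subst (_< _) (sym e) (ℕₚ.m≤n⇒m≤o+n 2 j<n)
... | inj₂ (_ , e) = subst (_< _) (sym e) (s≤s (s≤s j<n))

module _ {D} (M : PreMap D) where

  stem⇒fixed : ∀ g → T (isStem M g) → α M g ≡ g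
  stem⇒fixed g t with α M g ≟ g
  ... | yes e = e
  stem⇒fixed g () | no _

  stem⇒≢root : ∀ g → T (isStem M g) → g ≢ root M
  stem⇒≢root g t e with α M g ≟ g | g ≟ root M
  stem⇒≢root g () e | yes _ | yes _
  ... | yes _ | no g≢r = g≢r e
  stem⇒≢root g () e | no _  | _

  edge⇒unfixed : ∀ g → T (isEdge M g) → α M g ≢ g
  edge⇒unfixed g t e with α M g ≟ g
  edge⇒unfixed g () e | yes _
  ... | no ne = ne e

  stepZ-stem : ∀ g → T (isStem M g) → stepZ M g ≡ 1ℤ
  stepZ-stem g t rewrite stem⇒fixed g t | ⌊≟⌋-refl g = refl

  stepZ-edge : ∀ g → T (isEdge M g) → stepZ M g ≡ -1ℤ
  stepZ-edge g t = if-false (⌊≟⌋-≢ (edge⇒unfixed g t))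

  angle : ℕ → Fin D
  angle j = iter j (φ M) (ρ M)

  σT-cases : ∀ g → (σ M g ≡ root M × σT M g ≡ ρ M) ⊎ (σ M g ≢ root M × σT M g ≡ σ M g)
  σT-cases g with σ M g ≟ root M
  ... | yes e  = inj₁ (e , refl)
  ... | no  ne = inj₂ (ne , refl)

record WellFormed {D} (M : PreMap D) : Set where
  field
    σ-injective  : ∀ g h → σ M g ≡ σ M h → g ≡ h
    α-involutive : ∀ g → α M (α M g) ≡ g
    α-fixes-root : α M (root M) ≡ root M

module FaceWalk {D} {M : PreMap D} (wf : WellFormed M) where
  open WellFormed wf

  φ-injective : ∀ g h → φ M g ≡ φ M h → g ≡ h
  φ-injective g h e =
    trans (sym (α-involutive g)) (trans (cong (α M) (σ-injective _ _ e)) (α-involutive h))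

  φ-root : φ M (root M) ≡ ρ M
  φ-root = cong (σ M) α-fixes-root

  unfixed⇒≢root : ∀ g → α M g ≢ g → g ≢ root M
  unfixed⇒≢root g ne e = ne (trans (cong (α M) e) (trans α-fixes-root (sym e)))

  module Period (ℓ : ℕ) (reaches-root : angle M ℓ ≡ root M)
                (avoids-root : ∀ j → j < ℓ → angle M j ≢ root M) where

    angle-injective : ∀ a b → a ≤ ℓ → b ≤ ℓ → angle M a ≡ angle M b → a ≡ b
    angle-injective zero    zero    _   _   _ = refl
    angle-injective zero    (suc b) _   b<ℓ e =
      ⊥-elim (avoids-root b b<ℓ (φ-injective _ _ (trans (sym e) (sym φ-root))))
    angle-injective (suc a) zero    a<ℓ _   e =
      ⊥-elim (avoids-root a a<ℓ (φ-injective _ _ (trans e (sym φ-root))))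
    angle-injective (suc a) (suc b) a<ℓ b<ℓ e =
      cong suc (angle-injective a b (ℕₚ.<⇒≤ a<ℓ) (ℕₚ.<⇒≤ b<ℓ) (φ-injective _ _ e))

    angle-reduce : ∀ i → Σ ℕ λ j → j ≤ ℓ × angle M i ≡ angle M j
    angle-reduce zero = zero , z≤n , refl
    angle-reduce (suc i) with angle-reduce i
    ... | j , j≤ℓ , e with ℓ ≤? j
    ...   | yes ℓ≤j = zero , z≤n , trans (cong (φ M) e)
                (trans (cong (φ M) (trans (cong (angle M) (ℕₚ.≤-antisym j≤ℓ ℓ≤j)) reaches-root)) φ-root)
    ...   | no  ℓ≰j = suc j , ℕₚ.≰⇒> ℓ≰j , cong (φ M) e

-- Closing one stem

module Closing {D} {M : PreMap D} (wf : WellFormed M) (s : Fin D) (s-fixed : α M s ≡ s)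
               (s≢root : s ≢ root M) (y-unfixed : α M (yOf M s) ≢ yOf M s) where
  open WellFormed wf

  private
    y : Fin D
    y = yOf M s
    M' : PreMap (suc D)
    M' = close M s

  α-close : ∀ g → (g ≡ s × α M' (suc g) ≡ zero) ⊎ (g ≢ s × α M' (suc g) ≡ suc (α M g))
  α-close g with g ≟ s
  ... | yes e  = inj₁ (e , refl)
  ... | no  ne = inj₂ (ne , refl)

  σ-close : ∀ g → (g ≡ α M y × σ M' (suc g) ≡ zero) ⊎ (g ≢ α M y × σ M' (suc g) ≡ suc (σ M g))
  σ-close g with g ≟ α M y
  ... | yes e  = inj₁ (e , refl)
  ... | no  ne = inj₂ (ne , refl)

  α-close-≢ : ∀ g → g ≢ s → α M' (suc g) ≡ suc (α M g)
  α-close-≢ g ne = if-false (⌊≟⌋-≢ ne)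

  σ-close-≢ : ∀ g → g ≢ α M y → σ M' (suc g) ≡ suc (σ M g)
  σ-close-≢ g ne = if-false (⌊≟⌋-≢ ne)

  φ-close-stem : φ M' (suc s) ≡ suc (attachAngle M s)
  φ-close-stem rewrite ⌊≟⌋-refl s = refl

  φ-close : ∀ g → g ≢ s → g ≢ y → φ M' (suc g) ≡ suc (φ M g)
  φ-close g g≢s g≢y rewrite α-close-≢ g g≢s =
    σ-close-≢ (α M g) λ e → g≢y (trans (sym (α-involutive g)) (trans (cong (α M) e) (α-involutive y)))

  ρ-close : ρ M' ≡ suc (ρ M)
  ρ-close = σ-close-≢ (root M) λ e → y-unfixed (trans (sym e) (sym (y≡root e)))
    where
    y≡root : root M ≡ α M y → y ≡ root M
    y≡root e = trans (sym (α-involutive y)) (trans (cong (α M) (sym e)) α-fixes-root)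

  stepZ-close : ∀ g → g ≢ s → stepZ M' (suc g) ≡ stepZ M g
  stepZ-close g ne rewrite α-close-≢ g ne | ⌊suc≟suc⌋ (α M g) g = refl

  stepZ-close-stem : stepZ M' (suc s) ≡ -1ℤ
  stepZ-close-stem rewrite ⌊≟⌋-refl s = refl

  σ-close-injective : ∀ a b → σ M' a ≡ σ M' b → a ≡ b
  σ-close-injective zero    zero    e = refl
  σ-close-injective zero    (suc h) e with σ-close h
  ... | inj₁ (_ , e₂)  = ⊥-elim (Finₚ.0≢1+n (sym (trans e e₂)))
  ... | inj₂ (ne , e₂) = ⊥-elim (ne (sym (σ-injective _ _ (Finₚ.suc-injective (trans e e₂)))))
  σ-close-injective (suc g) zero    e with σ-close g
  ... | inj₁ (_ , e₂)  = ⊥-elim (Finₚ.0≢1+n (sym (trans (sym e) e₂)))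
  ... | inj₂ (ne , e₂) = ⊥-elim (ne (σ-injective _ _ (Finₚ.suc-injective (trans (sym e₂) e))))
  σ-close-injective (suc g) (suc h) e with σ-close g | σ-close h
  ... | inj₁ (e₁ , _) | inj₁ (e₂ , _) = cong suc (trans e₁ (sym e₂))
  ... | inj₁ (_ , e₁) | inj₂ (_ , e₂) = ⊥-elim (Finₚ.0≢1+n (trans (sym e₁) (trans e e₂)))
  ... | inj₂ (_ , e₁) | inj₁ (_ , e₂) = ⊥-elim (Finₚ.0≢1+n (trans (sym e₂) (trans (sym e) e₁)))
  ... | inj₂ (_ , e₁) | inj₂ (_ , e₂) =
    cong suc (σ-injective _ _ (Finₚ.suc-injective (trans (sym e₁) (trans e e₂))))

  α-close-involutive : ∀ g → α M' (α M' g) ≡ g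
  α-close-involutive zero rewrite ⌊≟⌋-refl s = refl
  α-close-involutive (suc g) with α-close g
  ... | inj₁ (e , e₁) rewrite e₁ = cong suc (sym e)
  ... | inj₂ (ne , e₁) rewrite e₁ with α-close (α M g)
  ...   | inj₁ (e₂ , _) = ⊥-elim (ne (trans (sym (α-involutive g)) (trans (cong (α M) e₂) s-fixed)))
  ...   | inj₂ (_ , e₃) = trans e₃ (cong suc (α-involutive g))

  close-wellFormed : WellFormed M'
  close-wellFormed = record
    { σ-injective  = σ-close-injective
    ; α-involutive = α-close-involutive
    ; α-fixes-root = trans (α-close-≢ (root M) (λ e → s≢root (sym e))) (cong suc α-fixes-root)
    }

-- The invariant of the closure

module Labelling {d₀} (M₀ : PreMap d₀) where

  -- orig sends each angle to the angle of Γ it comes from.  index₀ j is the position, in the walk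
  -- around Γ, of the origin of the j-th angle; the angles of Γ passed over in between have been
  -- enclosed in the triangles closed so far, and carry labels at least that of the j-th angle.
  record LabelledFace {D} (M : PreMap D) (orig : Fin D → Fin d₀) (sp : Fin D) : Set where
    field
      wellFormed        : WellFormed M
      ℓ                 : ℕ
      reaches-root      : angle M ℓ ≡ root M
      avoids-root       : ∀ j → j < ℓ → angle M j ≢ root M
      special           : SameFace M (ρ M) sp
      label-ρ           : λ₀ M₀ (orig (ρ M)) ≡ + 3
      label-root        : λ₀ M₀ (orig (root M)) ≡ 0ℤ
      label-step        : ∀ j → j < ℓ →
        λ₀ M₀ (orig (angle M (suc j))) ≡ λ₀ M₀ (orig (angle M j)) +ℤ stepZ M (angle M j)
      index₀            : ℕ → ℕ
      orig-angle        : ∀ j → j ≤ ℓ → orig (angle M j) ≡ angle M₀ (index₀ j)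
      index₀-increasing : ∀ j → j < ℓ → index₀ j < index₀ (suc j)
      passed-over-≥     : ∀ j → j < ℓ → ∀ r → index₀ j < r → r < index₀ (suc j) →
        λ₀ M₀ (orig (angle M j)) ≤ℤ λ₀ M₀ (angle M₀ r)

  AttachLabels : Fin d₀ → Fin d₀ → Set
  AttachLabels s a = λ₀ M₀ a ≡ λ₀ M₀ s -ℤ 1ℤ
    × (∀ j → 1 ≤ j → (∀ t → 1 ≤ t → t ≤ j → iter t (φ M₀) s ≢ a) →
        λ₀ M₀ s ≤ℤ λ₀ M₀ (iter j (φ M₀) s))

  module Step {D} {M : PreMap D} {orig : Fin D → Fin d₀} {sp : Fin D}
    (I : LabelledFace M orig sp) (s : Fin D) (admissible : Admissible M sp s)
    (safe : SameFace (close M s) (suc s) (ρ (close M s)))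
    (orig' : Fin (suc D) → Fin d₀) (orig'-old : ∀ g → orig' (suc g) ≡ orig g)
    where
    open LabelledFace I
    open WellFormed wellFormed
    open FaceWalk wellFormed
    open Period ℓ reaches-root avoids-root

    M' : PreMap (suc D)
    M' = close M s
    x y at : Fin D
    x  = xOf M s
    y  = yOf M s
    at = attachAngle M s

    label : Fin D → ℤ
    label g = λ₀ M₀ (orig g)

    s-stem : T (isStem M s)
    s-stem = proj₁ admissible
    x-edge : T (isEdge M x)
    x-edge = proj₁ (proj₂ admissible)
    y-edge : T (isEdge M y)
    y-edge = proj₁ (proj₂ (proj₂ admissible))

    s-fixed : α M s ≡ s
    s-fixed = stem⇒fixed M s s-stem
    x-unfixed : α M x ≢ x
    x-unfixed = edge⇒unfixed M x x-edge
    y-unfixed : α M y ≢ y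
    y-unfixed = edge⇒unfixed M y y-edge

    open Closing wellFormed s s-fixed (stem⇒≢root M s s-stem) y-unfixed

    Result : Set
    Result = LabelledFace M' orig' (suc s) × AttachLabels (orig s) (orig at)

    module Consecutive (p : ℕ) (3+p≤ℓ : suc (suc (suc p)) ≤ ℓ) (angle-p : angle M p ≡ s)
                   (angle-1+p : angle M (suc p) ≡ x) (angle-2+p : angle M (suc (suc p)) ≡ y) where
      open ≡-Reasoning

      angle-3+p : angle M (suc (suc (suc p))) ≡ at
      angle-3+p = cong (φ M) angle-2+p

      2+p<ℓ : suc (suc p) < ℓ
      2+p<ℓ = 3+p≤ℓ
      1+p<ℓ : suc p < ℓ
      1+p<ℓ = ℕₚ.<-trans (ℕₚ.n<1+n _) 2+p<ℓ
      p<ℓ : p < ℓ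
      p<ℓ = ℕₚ.<-trans (ℕₚ.n<1+n _) 1+p<ℓ
      p≤ℓ : p ≤ ℓ
      p≤ℓ = ℕₚ.<⇒≤ p<ℓ

      ℓ' : ℕ
      ℓ' = ℓ ∸ 2
      ℓ≡2+ℓ' : suc (suc ℓ') ≡ ℓ
      ℓ≡2+ℓ' = ℕₚ.m+[n∸m]≡n {2} {ℓ} (ℕₚ.≤-trans (s≤s (s≤s z≤n)) 3+p≤ℓ)

      p<ℓ' : p < ℓ'
      p<ℓ' = s≤s⁻¹ (s≤s⁻¹ (subst (suc (suc (suc p)) ≤_) (sym ℓ≡2+ℓ') 3+p≤ℓ))
      p≤ℓ' : p ≤ ℓ'
      p≤ℓ' = ℕₚ.<⇒≤ p<ℓ'

      skip-≤ℓ : ∀ {j} → j ≤ ℓ' → skip p j ≤ ℓ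
      skip-≤ℓ j≤ℓ' = subst (_ ≤_) ℓ≡2+ℓ' (skip-≤-2+ j≤ℓ')
      skip-<ℓ : ∀ {j} → j < ℓ' → skip p j < ℓ
      skip-<ℓ j<ℓ' = subst (_ <_) ℓ≡2+ℓ' (skip-<-2+ j<ℓ')

      skip-p : skip p p ≡ p
      skip-p = skip-≤ ℕₚ.≤-refl
      skip-1+p : skip p (suc p) ≡ suc (suc (suc p))
      skip-1+p = skip-> ℕₚ.≤-refl

      angle-skip-≢s : ∀ {j} → j ≤ ℓ' → j ≢ p → angle M (skip p j) ≢ s
      angle-skip-≢s j≤ℓ' j≢p e =
        skip-≢ j≢p (angle-injective _ p (skip-≤ℓ j≤ℓ') p≤ℓ (trans e (sym angle-p)))

      angle-skip-≢y : ∀ {j} → j ≤ ℓ' → j ≢ p → angle M (skip p j) ≢ y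
      angle-skip-≢y j≤ℓ' j≢p e =
        skip-≢2+ j≢p (angle-injective _ _ (skip-≤ℓ j≤ℓ') (ℕₚ.<⇒≤ 2+p<ℓ) (trans e (sym angle-2+p)))

      angle-close : ∀ j → j ≤ ℓ' → angle M' j ≡ suc (angle M (skip p j))
      angle-close zero    _ = trans ρ-close (cong (λ z → suc (angle M z)) (sym (skip-≤ {p} z≤n)))
      angle-close (suc j) j<ℓ' with j ℕₚ.≟ p
      ... | yes refl = begin
        φ M' (angle M' p)                   ≡⟨ cong (φ M') (angle-close p (ℕₚ.<⇒≤ j<ℓ')) ⟩
        φ M' (suc (angle M (skip p p)))     ≡⟨ cong (λ z → φ M' (suc (angle M z))) skip-p ⟩
        φ M' (suc (angle M p))              ≡⟨ cong (λ z → φ M' (suc z)) angle-p ⟩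
        φ M' (suc s)                        ≡⟨ φ-close-stem ⟩
        suc at                              ≡⟨ cong suc (sym angle-3+p) ⟩
        suc (angle M (suc (suc (suc p))))   ≡⟨ cong (λ z → suc (angle M z)) (sym skip-1+p) ⟩
        suc (angle M (skip p (suc p)))      ∎
      ... | no j≢p = begin
        φ M' (angle M' j)                   ≡⟨ cong (φ M') (angle-close j (ℕₚ.<⇒≤ j<ℓ')) ⟩
        φ M' (suc (angle M (skip p j)))     ≡⟨ φ-close _ (angle-skip-≢s (ℕₚ.<⇒≤ j<ℓ') j≢p)
                                                         (angle-skip-≢y (ℕₚ.<⇒≤ j<ℓ') j≢p) ⟩
        suc (angle M (suc (skip p j)))      ≡⟨ cong (λ z → suc (angle M z)) (sym (skip-suc j≢p)) ⟩
        suc (angle M (skip p (suc j)))      ∎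

      label-angle-close : ∀ j → j ≤ ℓ' → λ₀ M₀ (orig' (angle M' j)) ≡ label (angle M (skip p j))
      label-angle-close j j≤ℓ' = cong (λ₀ M₀) (trans (cong orig' (angle-close j j≤ℓ')) (orig'-old _))

      Lp : ℤ
      Lp = label (angle M p)

      label-1+p : label (angle M (suc p)) ≡ Lp +ℤ 1ℤ
      label-1+p = trans (label-step p p<ℓ)
        (cong (Lp +ℤ_) (trans (cong (stepZ M) angle-p) (stepZ-stem M s s-stem)))

      label-2+p : label (angle M (suc (suc p))) ≡ Lp
      label-2+p = begin
        label (angle M (suc (suc p)))        ≡⟨ label-step (suc p) 1+p<ℓ ⟩
        label (angle M (suc p)) +ℤ stepZ M (angle M (suc p))
                                             ≡⟨ cong₂ _+ℤ_ label-1+p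
                                                  (trans (cong (stepZ M) angle-1+p) (stepZ-edge M x x-edge)) ⟩
        (Lp +ℤ 1ℤ) +ℤ -1ℤ                   ≡⟨ ℤₚ.+-assoc Lp 1ℤ -1ℤ ⟩
        Lp +ℤ 0ℤ                             ≡⟨ ℤₚ.+-identityʳ Lp ⟩
        Lp                                   ∎

      label-3+p : label (angle M (suc (suc (suc p)))) ≡ Lp +ℤ -1ℤ
      label-3+p = trans (label-step (suc (suc p)) 2+p<ℓ)
        (cong₂ _+ℤ_ label-2+p (trans (cong (stepZ M) angle-2+p) (stepZ-edge M y y-edge)))

      label₀-index₀ : ∀ j → j ≤ ℓ → λ₀ M₀ (angle M₀ (index₀ j)) ≡ label (angle M j)
      label₀-index₀ j j≤ℓ = cong (λ₀ M₀) (sym (orig-angle j j≤ℓ))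

      index₀-p<index₀-3+p : index₀ p < index₀ (suc (suc (suc p)))
      index₀-p<index₀-3+p = ℕₚ.<-trans (index₀-increasing p p<ℓ)
        (ℕₚ.<-trans (index₀-increasing (suc p) 1+p<ℓ) (index₀-increasing (suc (suc p)) 2+p<ℓ))

      enclosed-≥ : ∀ r → index₀ p < r → r < index₀ (suc (suc (suc p))) → Lp ≤ℤ λ₀ M₀ (angle M₀ r)
      enclosed-≥ r p< <3+p with ℕₚ.<-cmp r (index₀ (suc p))
      ... | tri< r<1+p _ _ = passed-over-≥ p p<ℓ r p< r<1+p
      ... | tri≈ _ refl _ = ℤₚ.≤-trans (ℤₚ.i≤i+j Lp 1ℤ)
              (ℤₚ.≤-reflexive (sym (trans (label₀-index₀ (suc p) (ℕₚ.<⇒≤ 1+p<ℓ)) label-1+p)))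
      ... | tri> _ _ 1+p<r with ℕₚ.<-cmp r (index₀ (suc (suc p)))
      ...   | tri< r<2+p _ _ = ℤₚ.≤-trans (ℤₚ.i≤i+j Lp 1ℤ)
              (subst (_≤ℤ _) label-1+p (passed-over-≥ (suc p) 1+p<ℓ r 1+p<r r<2+p))
      ...   | tri≈ _ refl _ =
              ℤₚ.≤-reflexive (sym (trans (label₀-index₀ (suc (suc p)) (ℕₚ.<⇒≤ 2+p<ℓ)) label-2+p))
      ...   | tri> _ _ 2+p<r = subst (_≤ℤ _) label-2+p (passed-over-≥ (suc (suc p)) 2+p<ℓ r 2+p<r <3+p)

      label-p' : λ₀ M₀ (orig' (angle M' p)) ≡ Lp
      label-p' = trans (label-angle-close p p≤ℓ') (cong (λ z → label (angle M z)) skip-p)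

      angle'-p : angle M' p ≡ suc s
      angle'-p = trans (angle-close p p≤ℓ') (cong suc (trans (cong (angle M) skip-p) angle-p))

      label-step' : ∀ j → j < ℓ' →
        λ₀ M₀ (orig' (angle M' (suc j))) ≡ λ₀ M₀ (orig' (angle M' j)) +ℤ stepZ M' (angle M' j)
      label-step' j j<ℓ' with j ℕₚ.≟ p
      ... | yes refl = begin
        λ₀ M₀ (orig' (angle M' (suc p)))   ≡⟨ label-angle-close (suc p) j<ℓ' ⟩
        label (angle M (skip p (suc p)))   ≡⟨ cong (λ z → label (angle M z)) skip-1+p ⟩
        label (angle M (suc (suc (suc p)))) ≡⟨ label-3+p ⟩
        Lp +ℤ -1ℤ                          ≡⟨ cong₂ _+ℤ_ (sym label-p')
                                                (sym (trans (cong (stepZ M') angle'-p) stepZ-close-stem)) ⟩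
        λ₀ M₀ (orig' (angle M' p)) +ℤ stepZ M' (angle M' p) ∎
      ... | no j≢p = begin
        λ₀ M₀ (orig' (angle M' (suc j)))   ≡⟨ label-angle-close (suc j) j<ℓ' ⟩
        label (angle M (skip p (suc j)))   ≡⟨ cong (λ z → label (angle M z)) (skip-suc j≢p) ⟩
        label (angle M (suc (skip p j)))   ≡⟨ label-step (skip p j) (skip-<ℓ j<ℓ') ⟩
        label (angle M (skip p j)) +ℤ stepZ M (angle M (skip p j))
          ≡⟨ cong₂ _+ℤ_ (sym (label-angle-close j (ℕₚ.<⇒≤ j<ℓ')))
               (sym (trans (cong (stepZ M') (angle-close j (ℕₚ.<⇒≤ j<ℓ')))
                           (stepZ-close _ (angle-skip-≢s (ℕₚ.<⇒≤ j<ℓ') j≢p)))) ⟩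
        λ₀ M₀ (orig' (angle M' j)) +ℤ stepZ M' (angle M' j) ∎

      index₀' : ℕ → ℕ
      index₀' j = index₀ (skip p j)

      index₀'-increasing : ∀ j → j < ℓ' → index₀' j < index₀' (suc j)
      index₀'-increasing j j<ℓ' with j ℕₚ.≟ p
      ... | yes refl =
        subst₂ (λ a b → index₀ a < index₀ b) (sym skip-p) (sym skip-1+p) index₀-p<index₀-3+p
      ... | no j≢p   = subst (λ z → index₀' j < index₀ z) (sym (skip-suc j≢p))
                         (index₀-increasing (skip p j) (skip-<ℓ j<ℓ'))

      passed-over-≥' : ∀ j → j < ℓ' → ∀ r → index₀' j < r → r < index₀' (suc j) →
        λ₀ M₀ (orig' (angle M' j)) ≤ℤ λ₀ M₀ (angle M₀ r)
      passed-over-≥' j j<ℓ' r j< <1+j with j ℕₚ.≟ p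
      ... | yes refl = subst (_≤ℤ _) (sym label-p')
              (enclosed-≥ r (subst (λ z → index₀ z < r) skip-p j<)
                            (subst (λ z → r < index₀ z) skip-1+p <1+j))
      ... | no j≢p   = subst (_≤ℤ _) (sym (label-angle-close j (ℕₚ.<⇒≤ j<ℓ')))
              (passed-over-≥ (skip p j) (skip-<ℓ j<ℓ') r j<
                             (subst (λ z → r < index₀ z) (skip-suc j≢p) <1+j))

      closed : LabelledFace M' orig' (suc s)
      closed = record
        { wellFormed        = close-wellFormed
        ; ℓ                 = ℓ'
        ; reaches-root      = trans (angle-close ℓ' ℕₚ.≤-refl) (cong suc
                                (trans (cong (angle M) (trans (skip-> p<ℓ') ℓ≡2+ℓ')) reaches-root))
        ; avoids-root       = λ j j<ℓ' e → avoids-root (skip p j) (skip-<ℓ j<ℓ')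
                                (Finₚ.suc-injective (trans (sym (angle-close j (ℕₚ.<⇒≤ j<ℓ'))) e))
        ; special           = p , angle'-p
        ; label-ρ           = trans (cong (λ₀ M₀) (trans (cong orig' ρ-close) (orig'-old (ρ M)))) label-ρ
        ; label-root        = trans (cong (λ₀ M₀) (orig'-old (root M))) label-root
        ; label-step        = label-step'
        ; index₀            = index₀'
        ; orig-angle        = λ j j≤ℓ' → trans (cong orig' (angle-close j j≤ℓ'))
                                (trans (orig'-old _) (orig-angle (skip p j) (skip-≤ℓ j≤ℓ')))
        ; index₀-increasing = index₀'-increasing
        ; passed-over-≥     = passed-over-≥'
        }

      orig-s : orig s ≡ angle M₀ (index₀ p)
      orig-s = trans (cong orig (sym angle-p)) (orig-angle p p≤ℓ)

      label-s : λ₀ M₀ (orig s) ≡ Lp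
      label-s = cong label (sym angle-p)

      attach-label : λ₀ M₀ (orig at) ≡ λ₀ M₀ (orig s) -ℤ 1ℤ
      attach-label = trans (cong label (sym angle-3+p)) (trans label-3+p (cong (_-ℤ 1ℤ) (sym label-s)))

      before-attach-≥ : ∀ j → 1 ≤ j → (∀ t → 1 ≤ t → t ≤ j → iter t (φ M₀) (orig s) ≢ orig at) →
        λ₀ M₀ (orig s) ≤ℤ λ₀ M₀ (iter j (φ M₀) (orig s))
      before-attach-≥ j 1≤j not-yet with (j + index₀ p) <? index₀ (suc (suc (suc p)))
      ... | yes enclosed = subst₂ _≤ℤ_ (sym label-s) (cong (λ₀ M₀) (sym iter-s))
              (enclosed-≥ (j + index₀ p) (ℕₚ.m<n+m (index₀ p) 1≤j) enclosed)
        where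
        iter-s : iter j (φ M₀) (orig s) ≡ angle M₀ (j + index₀ p)
        iter-s = trans (cong (iter j (φ M₀)) orig-s) (sym (iter-+ j (index₀ p) _ _))
      ... | no beyond = ⊥-elim (not-yet t 1≤t t≤j reaches-a)
        where
        -- a(s) is t steps after s in the walk around Γ
        t : ℕ
        t = index₀ (suc (suc (suc p))) ∸ index₀ p
        1≤t : 1 ≤ t
        1≤t = ℕₚ.m<n⇒0<n∸m index₀-p<index₀-3+p
        t≤j : t ≤ j
        t≤j = subst (t ≤_) (ℕₚ.m+n∸n≡m j (index₀ p))
                (ℕₚ.∸-monoˡ-≤ (index₀ p) (ℕₚ.≮⇒≥ beyond))
        reaches-a : iter t (φ M₀) (orig s) ≡ orig at
        reaches-a = begin
          iter t (φ M₀) (orig s)                   ≡⟨ cong (iter t (φ M₀)) orig-s ⟩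
          iter t (φ M₀) (angle M₀ (index₀ p))      ≡⟨ sym (iter-+ t (index₀ p) _ _) ⟩
          angle M₀ (t + index₀ p)
            ≡⟨ cong (angle M₀) (ℕₚ.m∸n+n≡m (ℕₚ.<⇒≤ index₀-p<index₀-3+p)) ⟩
          angle M₀ (index₀ (suc (suc (suc p))))    ≡⟨ sym (orig-angle _ 3+p≤ℓ) ⟩
          orig (angle M (suc (suc (suc p))))       ≡⟨ cong orig angle-3+p ⟩
          orig at                                  ∎

      result : Result
      result = closed , attach-label , before-attach-≥

    stem-position : Σ ℕ λ p → p ≤ ℓ × angle M p ≡ s
    stem-position with special | proj₂ (proj₂ (proj₂ admissible))
    ... | q , angle-q | i , iter-i with angle-reduce (i + q)
    ...   | p , p≤ℓ , e = p , p≤ℓ , (begin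
      angle M p                    ≡⟨ sym e ⟩
      angle M (i + q)              ≡⟨ iter-+ i q (φ M) (ρ M) ⟩
      iter i (φ M) (angle M q)     ≡⟨ cong (iter i (φ M)) angle-q ⟩
      iter i (φ M) sp              ≡⟨ iter-i ⟩
      s                            ∎)
      where open ≡-Reasoning

    module AtPosition (p : ℕ) (p≤ℓ : p ≤ ℓ) (angle-p : angle M p ≡ s) where

      p<ℓ : p < ℓ
      p<ℓ = ℕₚ.≤∧≢⇒< p≤ℓ λ p≡ℓ →
        stem⇒≢root M s s-stem (trans (sym angle-p) (trans (cong (angle M) p≡ℓ) reaches-root))

      angle-1+p : angle M (suc p) ≡ σ M s
      angle-1+p = trans (cong (φ M) angle-p) (cong (σ M) s-fixed)

      -- If the new edge goes back to the angle at a position lo ≥ 1 without passing y, the face on the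
      -- right of the closed stem is the cycle of the angles lo … p, which misses the root angle.
      root-cut-off : ∀ lo → 1 ≤ lo → lo ≤ p → at ≡ angle M lo →
        (∀ j → lo ≤ j → j < p → angle M j ≢ y) → ⊥
      root-cut-off lo 1≤lo lo≤p at≡ y-absent
        with iter-preserves InCycle φ'-InCycle (proj₁ safe)
               (p , lo≤p , ℕₚ.≤-refl , cong suc (sym angle-p))
        where
        InCycle : Fin (suc D) → Set
        InCycle g = Σ ℕ λ j → lo ≤ j × j ≤ p × g ≡ suc (angle M j)
        φ'-InCycle : ∀ g → InCycle g → InCycle (φ M' g)
        φ'-InCycle g (j , lo≤j , j≤p , refl) with j ℕₚ.≟ p
        ... | yes refl = lo , ℕₚ.≤-refl , lo≤p ,
                trans (cong (λ z → φ M' (suc z)) angle-p) (trans φ-close-stem (cong suc at≡))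
        ... | no j≢p = suc j , ℕₚ.m≤n⇒m≤1+n lo≤j , ℕₚ.≤∧≢⇒< j≤p j≢p ,
                φ-close _ (λ e → j≢p (angle-injective j p (ℕₚ.≤-trans j≤p p≤ℓ) p≤ℓ
                                                      (trans e (sym angle-p))))
                          (y-absent j lo≤j (ℕₚ.≤∧≢⇒< j≤p j≢p))
      ... | j , lo≤j , j≤p , e = ℕₚ.<⇒≢ (ℕₚ.<-≤-trans 1≤lo lo≤j)
            (angle-injective 0 j z≤n (ℕₚ.≤-trans j≤p p≤ℓ)
              (Finₚ.suc-injective (trans (sym ρ-close) (trans (sym (proj₂ safe)) e))))

      unfixed-not-at-p : ∀ {g j} → α M g ≢ g → angle M j ≡ g → p ≢ j
      unfixed-not-at-p {g} {j} α-g≢g angle-j p≡j =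
        α-g≢g (trans (cong (α M) (sym s≡g)) (trans s-fixed s≡g))
        where
        s≡g : s ≡ g
        s≡g = trans (sym angle-p) (trans (cong (angle M) p≡j) angle-j)

      -- the root half-edge lies between s and x around w
      root-before-x : σ M s ≡ root M → σT M s ≡ ρ M → ⊥
      root-before-x σs≡root x≡ρ with σT-cases M (α M x)
      ... | inj₁ (σαx≡root , _) = unfixed-not-at-p x-unfixed (sym x≡ρ) p≡0
        where
        1≡ℓ : 1 ≡ ℓ
        1≡ℓ = angle-injective 1 ℓ (ℕₚ.≤-trans (s≤s z≤n) p<ℓ) ℕₚ.≤-refl
                (trans (cong (φ M) (sym x≡ρ)) (trans σαx≡root (sym reaches-root)))
        p≡0 : p ≡ 0
        p≡0 = ℕₚ.suc-injective (trans (angle-injective (suc p) ℓ p<ℓ ℕₚ.≤-refl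
                (trans angle-1+p (trans σs≡root (sym reaches-root)))) (sym 1≡ℓ))
      ... | inj₂ (_ , y≡σαx) = root-cut-off 2 (s≤s z≤n) 2≤p (cong (φ M) (sym angle-1≡y)) y-absent
        where
        angle-1≡y : angle M 1 ≡ y
        angle-1≡y = trans (cong (φ M) (sym x≡ρ)) (sym y≡σαx)
        2≤p : 2 ≤ p
        2≤p = ℕₚ.≤∧≢⇒< (ℕₚ.n≢0⇒n>0 (unfixed-not-at-p x-unfixed (sym x≡ρ)))
                       λ 1≡p → unfixed-not-at-p y-unfixed angle-1≡y (sym 1≡p)
        y-absent : ∀ j → 2 ≤ j → j < p → angle M j ≢ y
        y-absent j 2≤j j<p e = ℕₚ.<⇒≢ 2≤j (sym (angle-injective j 1 (ℕₚ.≤-trans (ℕₚ.<⇒≤ j<p) p≤ℓ)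
                                 (ℕₚ.≤-trans (s≤s z≤n) (ℕₚ.≤-trans 2≤p p≤ℓ)) (trans e (sym angle-1≡y))))

      -- the root half-edge lies between x and y around v
      root-before-y : σ M (α M x) ≡ root M → σT M (α M x) ≡ ρ M → ⊥
      root-before-y _ y≡ρ = root-cut-off 1 ℕₚ.≤-refl 1≤p (cong (φ M) y≡ρ) y-absent
        where
        1≤p : 1 ≤ p
        1≤p = ℕₚ.n≢0⇒n>0 (unfixed-not-at-p y-unfixed (sym y≡ρ))
        y-absent : ∀ j → 1 ≤ j → j < p → angle M j ≢ y
        y-absent j 1≤j j<p e =
          ℕₚ.<⇒≢ 1≤j (sym (angle-injective j 0 (ℕₚ.≤-trans (ℕₚ.<⇒≤ j<p) p≤ℓ) z≤n (trans e y≡ρ)))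

      result : Result
      result with σT-cases M s
      ... | inj₁ (σs≡root , x≡ρ) = ⊥-elim (root-before-x σs≡root x≡ρ)
      ... | inj₂ (_ , x≡σs) with σT-cases M (α M x)
      ...   | inj₁ (σαx≡root , y≡ρ) = ⊥-elim (root-before-y σαx≡root y≡ρ)
      ...   | inj₂ (_ , y≡σαx) = Consecutive.result p 3+p≤ℓ angle-p angle-1+p≡x angle-2+p≡y
        where
        angle-1+p≡x : angle M (suc p) ≡ x
        angle-1+p≡x = trans angle-1+p (sym x≡σs)
        angle-2+p≡y : angle M (suc (suc p)) ≡ y
        angle-2+p≡y = trans (cong (φ M) angle-1+p≡x) (sym y≡σαx)
        1+p<ℓ : suc p < ℓ
        1+p<ℓ = ℕₚ.≤∧≢⇒< p<ℓ λ e → unfixed⇒≢root x x-unfixed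
                  (trans (sym angle-1+p≡x) (trans (cong (angle M) e) reaches-root))
        3+p≤ℓ : suc (suc (suc p)) ≤ ℓ
        3+p≤ℓ = ℕₚ.≤∧≢⇒< 1+p<ℓ λ e → unfixed⇒≢root y y-unfixed
                  (trans (sym angle-2+p≡y) (trans (cong (angle M) e) reaches-root))

    result : Result
    result with stem-position
    ... | p , p≤ℓ , angle-p = AtPosition.result p p≤ℓ angle-p

  module Initial (n : ℕ) (1≤n : 1 ≤ n) (T : InTr M₀ n) where

    wf : WellFormed M₀
    wf = record { σ-injective = σ-inj T ; α-involutive = α-invol T ; α-fixes-root = InTr.α-root T }

    open FaceWalk wf

    first-root : Σ ℕ λ ℓ → angle M₀ ℓ ≡ root M₀ × (∀ j → j < ℓ → angle M₀ j ≢ root M₀)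
    first-root = least (λ j → angle M₀ j ≡ root M₀) (λ j → angle M₀ j ≟ root M₀)
                   (proj₁ (one-face T (ρ M₀) (root M₀))) (proj₂ (one-face T (ρ M₀) (root M₀)))

    ℓ : ℕ
    ℓ = proj₁ first-root
    reaches-root : angle M₀ ℓ ≡ root M₀
    reaches-root = proj₁ (proj₂ first-root)
    avoids-root : ∀ j → j < ℓ → angle M₀ j ≢ root M₀
    avoids-root = proj₂ (proj₂ first-root)

    open Period ℓ reaches-root avoids-root

    angleFin : Fin (suc ℓ) → Fin d₀
    angleFin k = angle M₀ (toℕ k)

    angleFin-injective : ∀ a b → angleFin a ≡ angleFin b → a ≡ b
    angleFin-injective a b e = Finₚ.toℕ-injective
      (angle-injective (toℕ a) (toℕ b) (s≤s⁻¹ (Finₚ.toℕ<n a)) (s≤s⁻¹ (Finₚ.toℕ<n b)) e)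

    angleFin-surjective : ∀ g → Σ (Fin (suc ℓ)) λ k → angleFin k ≡ g
    angleFin-surjective g with one-face T (ρ M₀) g
    ... | i , iter-i with angle-reduce i
    ...   | j , j≤ℓ , e = fromℕ< (s≤s j≤ℓ) ,
            trans (cong (angle M₀) (Finₚ.toℕ-fromℕ< (s≤s j≤ℓ))) (trans (sym e) iter-i)

    walk-permutation : Permutation (suc ℓ) d₀
    walk-permutation = permutation angleFin (λ g → proj₁ (angleFin-surjective g))
      (λ g → proj₂ (angleFin-surjective g))
      (λ k → angleFin-injective _ _ (proj₂ (angleFin-surjective (angleFin k))))

    ℓ<d₀ : ℓ < d₀
    ℓ<d₀ = Finₚ.injective⇒≤ {f = angleFin} (λ {a} {b} → angleFin-injective a b)

    pos-angle : ∀ j → j ≤ ℓ → pos M₀ (angle M₀ j) ≡ j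
    pos-angle j j≤ℓ = first-least d₀ _ j (ℕₚ.≤-<-trans j≤ℓ ℓ<d₀) (⌊≟⌋-refl (angle M₀ j))
      (λ i i<j → ⌊≟⌋-≢ λ e →
        ℕₚ.<⇒≢ i<j (angle-injective i j (ℕₚ.≤-trans (ℕₚ.<⇒≤ i<j) j≤ℓ) j≤ℓ e))

    label-angle : ∀ j → j ≤ ℓ → λ₀ M₀ (angle M₀ j) ≡ lab M₀ j
    label-angle j j≤ℓ = cong (lab M₀) (pos-angle j j≤ℓ)

    step : ℕ → ℤ
    step j = stepZ M₀ (angle M₀ j)

    lab≡3+prefixSum : ∀ i → lab M₀ i ≡ + 3 +ℤ prefixSum step i
    lab≡3+prefixSum zero    = refl
    lab≡3+prefixSum (suc i) =
      trans (cong (_+ℤ step i) (lab≡3+prefixSum i)) (ℤₚ.+-assoc (+ 3) (prefixSum step i) (step i))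

    walk-sum : prefixSum step (suc ℓ) ≡ sumZ (stepZ M₀)
    walk-sum = begin
      prefixSum step (suc ℓ)                   ≡⟨ sym (sumZ≡prefixSum (suc ℓ) step) ⟩
      sumZ {suc ℓ} (λ k → step (toℕ k))        ≡⟨ sym (sum≡sumZ {suc ℓ} (λ k → step (toℕ k))) ⟩
      sum {suc ℓ} (λ k → stepZ M₀ (angleFin k))
        ≡⟨ sym (sum-permute {suc ℓ} {d₀} (stepZ M₀) walk-permutation) ⟩
      sum (stepZ M₀)                           ≡⟨ sum≡sumZ (stepZ M₀) ⟩
      sumZ (stepZ M₀)                          ∎
      where open ≡-Reasoning

    root-fixed : isFixed M₀ (root M₀) ≡ true
    root-fixed rewrite InTr.α-root T = ⌊≟⌋-refl (root M₀)

    fixed∧≡root : ∀ g → (isFixed M₀ g ∧ ⌊ g ≟ root M₀ ⌋) ≡ ⌊ g ≟ root M₀ ⌋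
    fixed∧≡root g with g ≟ root M₀
    ... | yes refl rewrite root-fixed = refl
    ... | no _ with isFixed M₀ g
    ...   | true  = refl
    ...   | false = refl

    cnt-fixed : cnt (isFixed M₀) ≡ cnt (isStem M₀) + 1
    cnt-fixed = trans (cnt-∧-split (isFixed M₀) (λ g → ⌊ g ≟ root M₀ ⌋))
      (cong (λ z → cnt (isStem M₀) + z) (trans (cnt-cong fixed∧≡root) (cnt-≟ (root M₀))))

    -- 2n fixed darts (the 2n - 1 stems and the root half-edge) against 2n + 2 edge darts
    sum-stepZ : sumZ (stepZ M₀) ≡ -[1+ 1 ]
    sum-stepZ = begin
      sumZ (stepZ M₀)                          ≡⟨ sumZ-±1 (isFixed M₀) ⟩
      + cnt (isFixed M₀) -ℤ + cnt (isEdge M₀)  ≡⟨ cong₂ (λ a b → + a -ℤ + b) #fixed #edge ⟩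
      + (2 * n) -ℤ + (2 * n + 2)               ≡⟨ ℤₚ.m-n≡m⊖n (2 * n) (2 * n + 2) ⟩
      2 * n ⊖ (2 * n + 2)                      ≡⟨ m⊖[m+2] (2 * n) ⟩
      -[1+ 1 ]                                 ∎
      where
      open ≡-Reasoning
      #fixed : cnt (isFixed M₀) ≡ 2 * n
      #fixed = trans cnt-fixed (trans (cong (_+ 1) (stem-count T))
                 (ℕₚ.m∸n+n≡m (ℕₚ.≤-trans 1≤n (ℕₚ.m≤m+n n (n + 0)))))
      #edge : cnt (isEdge M₀) ≡ 2 * n + 2
      #edge = trans (edge-count T) (ℕₚ.*-distribˡ-+ 2 n 1)
      m⊖[m+2] : ∀ m → m ⊖ (m + 2) ≡ -[1+ 1 ]
      m⊖[m+2] zero    = refl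
      m⊖[m+2] (suc m) = trans (ℤₚ.[1+m]⊖[1+n]≡m⊖n m (m + 2)) (m⊖[m+2] m)

    lab-ℓ : lab M₀ ℓ ≡ 0ℤ
    lab-ℓ = begin
      lab M₀ ℓ                                 ≡⟨ sym (ℤₚ.+-identityʳ (lab M₀ ℓ)) ⟩
      lab M₀ ℓ +ℤ (1ℤ +ℤ -1ℤ)                  ≡⟨ sym (ℤₚ.+-assoc (lab M₀ ℓ) 1ℤ -1ℤ) ⟩
      (lab M₀ ℓ +ℤ 1ℤ) +ℤ -1ℤ                  ≡⟨ cong (λ z → (lab M₀ ℓ +ℤ z) +ℤ -1ℤ) (sym step-root) ⟩
      lab M₀ (suc ℓ) +ℤ -1ℤ                    ≡⟨ cong (_+ℤ -1ℤ) (lab≡3+prefixSum (suc ℓ)) ⟩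
      (+ 3 +ℤ prefixSum step (suc ℓ)) +ℤ -1ℤ   ≡⟨ cong (λ z → (+ 3 +ℤ z) +ℤ -1ℤ) (trans walk-sum sum-stepZ) ⟩
      0ℤ                                       ∎
      where
      open ≡-Reasoning
      step-root : step ℓ ≡ 1ℤ
      step-root = trans (cong (stepZ M₀) reaches-root) (if-true root-fixed)

    initial : LabelledFace M₀ (λ g → g) (ρ M₀)
    initial = record
      { wellFormed        = wf
      ; ℓ                 = ℓ
      ; reaches-root      = reaches-root
      ; avoids-root       = avoids-root
      ; special           = 0 , refl
      ; label-ρ           = label-angle 0 z≤n
      ; label-root        = trans (cong (λ₀ M₀) (sym reaches-root))
                              (trans (label-angle ℓ ℕₚ.≤-refl) lab-ℓ)
      ; label-step        = λ j j<ℓ → trans (label-angle (suc j) j<ℓ)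
                              (cong (_+ℤ step j) (sym (label-angle j (ℕₚ.<⇒≤ j<ℓ))))
      ; index₀            = λ j → j
      ; orig-angle        = λ _ _ → refl
      ; index₀-increasing = λ j _ → ℕₚ.n<1+n j
      ; passed-over-≥     = λ j _ r j<r r<1+j → ⊥-elim (ℕₚ.<⇒≱ r<1+j j<r)
      }

module _ {d} (M : PreMap d) (ch : (k : ℕ) → Fin (k + d)) where
  open Closure M ch
  open Labelling M

  L≡λ₀∘origin : ∀ k g → L k g ≡ λ₀ M (origin k g)
  L≡λ₀∘origin zero    g       = refl
  L≡λ₀∘origin (suc k) zero    = L≡λ₀∘origin k (attachAngle (Γ k) (ch k))
  L≡λ₀∘origin (suc k) (suc g) = L≡λ₀∘origin k g

  walkOK : ∀ k → SameFace (Γ k) (sp k) (ρ (Γ k)) → LabelledFace (Γ k) (origin k) (sp k) → WalkOK k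
  walkOK k sameFace I =
      sameFace
    , trans (L≡λ₀∘origin k _) label-ρ
    , steps
    , trans (L≡λ₀∘origin k _) label-root
    where
    open LabelledFace I
    step-L : ∀ i → i < ℓ →
      L k (angle (Γ k) (suc i)) ≡ L k (angle (Γ k) i) +ℤ stepZ (Γ k) (angle (Γ k) i)
    step-L i i<ℓ = trans (L≡λ₀∘origin k _)
      (trans (label-step i i<ℓ) (cong (_+ℤ stepZ (Γ k) (angle (Γ k) i)) (sym (L≡λ₀∘origin k _))))
    steps : ∀ i → (∀ j → j ≤ i → angle (Γ k) j ≢ root (Γ k)) →
        (T (isStem (Γ k) (angle (Γ k) i)) → L k (angle (Γ k) (suc i)) ≡ L k (angle (Γ k) i) +ℤ 1ℤ)
      × (T (isEdge (Γ k) (angle (Γ k) i)) → L k (angle (Γ k) (suc i)) ≡ L k (angle (Γ k) i) -ℤ 1ℤ)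
    steps i before-root with ℓ ≤? i
    ... | yes ℓ≤i = ⊥-elim (before-root ℓ ℓ≤i reaches-root)
    ... | no  ℓ≰i = (λ t → trans (step-L i i<ℓ) (cong (L k (angle (Γ k) i) +ℤ_) (stepZ-stem (Γ k) _ t)))
                  , (λ t → trans (step-L i i<ℓ) (cong (L k (angle (Γ k) i) +ℤ_) (stepZ-edge (Γ k) _ t)))
      where
      i<ℓ : i < ℓ
      i<ℓ = ℕₚ.≰⇒> ℓ≰i

lemma1 : ∀ (n : ℕ) → 1 ≤ n → ∀ {d} (M : PreMap d) (H : InTr M n) →
    Balanced M (InTr.vtx H) → Safe (2 * n ∸ 1) M →
    ∀ (ch : (k : ℕ) → Fin (k + d)) → Closure.Valid M ch (2 * n ∸ 1) →
      (∀ k → k ≤ 2 * n ∸ 1 → Closure.WalkOK M ch k)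
    × (∀ k → k < 2 * n ∸ 1 → Closure.AttachOK M ch k)
lemma1 n 1≤n M T _ safe ch valid = walk , attach
  where
  open Closure M ch
  open Labelling M
  K : ℕ
  K = 2 * n ∸ 1

  invariant : ∀ k → k ≤ K → LabelledFace (Γ k) (origin k) (sp k)
  closing   : ∀ k → k < K → LabelledFace (Γ (suc k)) (origin (suc k)) (sp (suc k))
                          × AttachLabels (origin k (ch k)) (origin k (attachAngle (Γ k) (ch k)))
  invariant zero    _   = Initial.initial n 1≤n T
  invariant (suc k) k<K = proj₁ (closing k k<K)
  closing k k<K = Step.result (invariant k (ℕₚ.<⇒≤ k<K)) (ch k) (valid k k<K) (safe ch valid k k<K)
                    (origin (suc k)) (λ _ → refl)

  root-in-special : ∀ k → k ≤ K → SameFace (Γ k) (sp k) (ρ (Γ k))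
  root-in-special zero    _   = 0 , refl
  root-in-special (suc k) k<K = safe ch valid k k<K

  walk : ∀ k → k ≤ K → WalkOK k
  walk k k≤K = walkOK M ch k (root-in-special k k≤K) (invariant k k≤K)

  attach : ∀ k → k < K → AttachOK k
  attach k k<K = proj₂ (closing k k<K)
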